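{- For every even integer $k\ge 2$ there exists a bipartite graph $G=(V_1\cup V_2,E)$ with $4.5k$ vertices such that none of Rules 1, 2 and 3 applies to $G$ and the minimum cost of a biclustering of $G$ is exactly $k$.
   Context: $N(x)$ denotes the neighborhood of $x$; for a set $X$ of vertices on one side, $N(X)=\bigcup_{x\in X}N(x)$. Two vertices on the same side are twins if they have the same neighborhood; a twin class is an equivalence class of this relation (possibly a single vertex). Given a twin class $R$ with $S=N(R)$, a vertex $t\in N(S)\setminus R$ is a sister of $R$ if $t$ has no twin in $G$ and $N(t)=S\cup\{v\}$ for some vertex $v\notin S$. A bicluster is a set $X\cup Y$ with $X\subseteq V_1$, $Y\subseteq V_2$ such that $N(x)=Y$ for all $x\in X$ and $N(y)=X$ for all $y\in Y$ (an isolated vertex is a bicluster); a bicluster graph is a graph each of whose connected components is a bicluster. A biclustering of $G$ is a bicluster graph $\mathcal{B}$ with $V(\mathcal{B})=V(G)$ all of whose edges go between $V_1$ and $V_2$; its cost is $|E(G)\triangle E(\mathcal{B})|$. Rule 1 applies if some connected component of $G$ is a bicluster. Rule 2 applies if there is a twin class $R$ with $|R|>|N(N(R))\setminus R|$. Rule 3 applies if there is a twin class $R$ such that, with $T$ the set of sisters of $R$ and $W=N(N(R))\setminus(R\cup T)$, we have $|R|>|W|$ and $|T|\ge 1$. -}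

module Defs where

open import Data.Nat using (ℕ; zero; suc; _+_; _<_; _≤_)
open import Data.Bool using (Bool; true; false; _∧_; _∨_; not; _xor_; if_then_else_)
open import Data.Fin using (Fin)
import Data.Fin as F
open import Data.Fin.Subset using (Subset; _∪_; _─_; ⁅_⁆; ∣_∣)
open import Data.Vec using (Vec; tabulate; lookup)
import Data.Vec.Properties as VP
import Data.Bool.Properties as BP
open import Data.Sum using (_⊎_; inj₁; inj₂)
open import Data.Product using (Σ; ∃; _×_; _,_)
open import Data.Empty using (⊥)
open import Function using (flip; _∘_)
open import Function.Bundles using (_⇔_)
open import Relation.Nullary.Decidable using (⌊_⌋)
open import Relation.Binary.PropositionalEquality using (_≡_)
open import Relation.Binary.Construct.Closure.ReflexiveTransitive using (Star)

-- A bipartite graph with sides V₁ = Fin a, V₂ = Fin b is given by its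
-- (decidable) adjacency  E : Fin a → Fin b → Bool.  All edges go between sides.
Graph : ℕ → ℕ → Set
Graph a b = Fin a → Fin b → Bool

transposeG : ∀ {a b} → Graph a b → Graph b a
transposeG = flip

anyF : ∀ {n} → (Fin n → Bool) → Bool
anyF {zero} f = false
anyF {suc n} f = f F.zero ∨ anyF (f ∘ F.suc)

allF : ∀ {n} → (Fin n → Bool) → Bool
allF {zero} f = true
allF {suc n} f = f F.zero ∧ allF (f ∘ F.suc)

sumF : ∀ {n} → (Fin n → ℕ) → ℕ
sumF {zero} f = 0
sumF {suc n} f = f F.zero + sumF (f ∘ F.suc)

subsetEq : ∀ {n} → Subset n → Subset n → Bool
subsetEq X Y = ⌊ VP.≡-dec BP._≟_ X Y ⌋

finEq : ∀ {n} → Fin n → Fin n → Bool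
finEq i j = ⌊ i F.≟ j ⌋

-- Neighbourhoods (for vertices of V₁; V₂ is handled via transposeG)

nbr : ∀ {a b} → Graph a b → Fin a → Subset b
nbr E x = tabulate (E x)

nbrSet : ∀ {a b} → Graph a b → Subset a → Subset b
nbrSet E X = tabulate (λ y → anyF (λ x → lookup X x ∧ E x y))

nbr2 : ∀ {a b} → Graph a b → Subset a → Subset a
nbr2 E X = nbrSet (transposeG E) (nbrSet E X)

twinClass : ∀ {a b} → Graph a b → Fin a → Subset a
twinClass E x = tabulate (λ x' → subsetEq (nbr E x') (nbr E x))

noTwin : ∀ {a b} → Graph a b → Fin a → Bool
noTwin E t = allF (λ t' → finEq t' t ∨ not (subsetEq (nbr E t') (nbr E t)))

isSister : ∀ {a b} → Graph a b → Subset a → Fin a → Bool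
isSister E R t =
  lookup (nbr2 E R) t ∧ not (lookup R t) ∧ noTwin E t ∧
  anyF (λ v → not (lookup (nbrSet E R) v) ∧ subsetEq (nbr E t) (nbrSet E R ∪ ⁅ v ⁆))

sisters : ∀ {a b} → Graph a b → Subset a → Subset a
sisters E R = tabulate (isSister E R)

Rule2₁ : ∀ {a b} → Graph a b → Set
Rule2₁ E = ∃ λ x → let R = twinClass E x in ∣ nbr2 E R ─ R ∣ < ∣ R ∣

Rule2 : ∀ {a b} → Graph a b → Set
Rule2 E = Rule2₁ E ⊎ Rule2₁ (transposeG E)

Rule3₁ : ∀ {a b} → Graph a b → Set
Rule3₁ E = ∃ λ x →
  let R = twinClass E x
      T = sisters E R
      W = nbr2 E R ─ (R ∪ T)
  in (∣ W ∣ < ∣ R ∣) × (1 ≤ ∣ T ∣)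

Rule3 : ∀ {a b} → Graph a b → Set
Rule3 E = Rule3₁ E ⊎ Rule3₁ (transposeG E)

Vtx : ℕ → ℕ → Set
Vtx a b = Fin a ⊎ Fin b

Adj : ∀ {a b} → Graph a b → Vtx a b → Vtx a b → Set
Adj E (inj₁ x) (inj₂ y) = E x y ≡ true
Adj E (inj₂ y) (inj₁ x) = E x y ≡ true
Adj E (inj₁ _) (inj₁ _) = ⊥
Adj E (inj₂ _) (inj₂ _) = ⊥

Reach : ∀ {a b} → Graph a b → Vtx a b → Vtx a b → Set
Reach E = Star (Adj E)

ComponentIsBicluster : ∀ {a b} → Graph a b → Vtx a b → Set
ComponentIsBicluster E v =
  (∀ x → Reach E v (inj₁ x) → ∀ y → (E x y ≡ true) ⇔ Reach E v (inj₂ y)) ×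
  (∀ y → Reach E v (inj₂ y) → ∀ x → (E x y ≡ true) ⇔ Reach E v (inj₁ x))

Rule1 : ∀ {a b} → Graph a b → Set
Rule1 E = ∃ λ v → ComponentIsBicluster E v

IsBiclusterGraph : ∀ {a b} → Graph a b → Set
IsBiclusterGraph B = ∀ v → ComponentIsBicluster B v

cost : ∀ {a b} → Graph a b → Graph a b → ℕ
cost E B = sumF (λ x → sumF (λ y → if E x y xor B x y then 1 else 0))

MinBiclusterCost : ∀ {a b} → Graph a b → ℕ → Set
MinBiclusterCost {a} {b} E k =
  (Σ (Graph a b) λ B → IsBiclusterGraph B × cost E B ≡ k) ×
  (∀ (B : Graph a b) → IsBiclusterGraph B → k ≤ cost E B)

{-# OPTIONS --safe #-}
-- The graph is the disjoint union of k/2 copies of a 9-vertex gadget.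
--
-- Bicluster graphs are exactly the bipartite graphs without an induced P4
-- (a path x₁y₁x₂y₂ with x₁y₂ missing). Every induced P4 forces an edit on one of
-- its four vertex pairs; the gadget has two induced P4s whose vertex pairs are
-- disjoint, so it needs two edits, and two deletions suffice. Edits on disjoint
-- unions add up, hence the minimum cost is k.
--
-- No rule applies because every vertex x carries, inside its own component, a
-- certificate that |R| ≤ |W| for its twin class R: R has at most two members,
-- and as many vertices at distance two from x are neither twins of x nor
-- sisters of R. Such a certificate also exhibits a vertex at distance two with
-- a different neighbourhood, so no component is a bicluster. Certificates
-- survive disjoint unions, and for the gadget they are found by a decision
-- procedure.

module Submission where

open import Defs
open import Data.Nat using (ℕ; zero; suc; _+_; _*_; _≤_; z≤n; s≤s)
open import Data.Nat.Properties
  using (≤-trans; ≤-reflexive; ≤⇒≯; n≤1+n; m≤m+n; m≤n+m; +-mono-≤; +-monoʳ-≤; +-suc; +-comm;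
         +-assoc; +-identityʳ; +-commutativeSemigroup; module ≤-Reasoning)
open import Data.Nat.Divisibility using (_∣_; divides)
open import Data.Nat.Solver using (module +-*-Solver)
open import Algebra.Properties.CommutativeSemigroup +-commutativeSemigroup using (interchange)
open import Data.Bool using (Bool; true; false; _∧_; _∨_; not; _xor_; if_then_else_)
open import Data.Bool.Properties using (∧-conicalˡ; ∧-conicalʳ; ∨-zeroʳ; ⇔→≡; T-≡)
  renaming (_≟_ to _≟ᵇ_)
open import Data.Fin using (Fin; zero; suc; _↑ˡ_; _↑ʳ_; splitAt)
open import Data.Fin.Patterns using (0F; 1F; 2F; 3F)
open import Data.Fin.Properties
  using (any?; all?; splitAt-↑ˡ; splitAt-↑ʳ; splitAt⁻¹-↑ˡ; splitAt⁻¹-↑ʳ; ↑ˡ-injective; ↑ʳ-injective)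
  renaming (_≟_ to _≟ᶠ_)
open import Data.Fin.Subset using (Subset; _∈_; _∉_; _⊆_; _∪_; _─_; ⁅_⁆; ∣_∣)
open import Data.Fin.Subset.Properties
  using (p⊆q⇒∣p∣≤∣q∣; ∣p─q∣≤∣p∣; p─q─r≡p─q∪r; x∈p∪q⁺; x∈p∪q⁻; x∈p∧x∉q⇒x∈p─q;
         x∈p∧x≢y⇒x∈p-y; x∈p⇒∣p-x∣<∣p∣; x∈⁅x⁆; x∈⁅y⁆⇒x≡y; ∣⁅x⁆∣≡1; ∪-idem)
open import Data.Vec using (Vec; []; _∷_; lookup; tabulate)
open import Data.Vec.Properties
  using (≡-dec; lookup∘tabulate; tabulate-cong; []=⇒lookup; lookup⇒[]=)
open import Data.Sum using (_⊎_; inj₁; inj₂; [_,_])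
import Data.Sum as Sum
open import Data.Product using (Σ; _×_; _,_; proj₁; ∃; ∃₂; map₂)
open import Function using (_∘_; _∘₂_)
open import Function.Bundles using (Equivalence; mk⇔)
open import Function.Definitions using (Injective)
import Function.Properties.Equivalence as ⇔
open import Relation.Nullary using (¬_; Dec; yes; no; ¬?; _×-dec_; _⊎-dec_; _→-dec_; contradiction)
open import Relation.Nullary.Decidable using (toWitness; fromWitness; from-yes)
open import Relation.Binary.PropositionalEquality
  using (_≡_; _≢_; refl; sym; trans; cong; cong₂; subst; ≢-sym; module ≡-Reasoning)
open import Relation.Binary.Construct.Closure.ReflexiveTransitive
  using (ε; _◅_; _◅◅_; reverse)

private variable
  a b c d a′ b′ n : ℕ

≡true≢≡false : ∀ {u v : Bool} → u ≡ true → v ≡ false → u ≢ v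
≡true≢≡false refl refl ()

∨≡true⁻ : ∀ {u v} → u ∨ v ≡ true → u ≡ true ⊎ v ≡ true
∨≡true⁻ {true}  _ = inj₁ refl
∨≡true⁻ {false} p = inj₂ p

subsetEq-sound : ∀ {X Y : Subset n} → subsetEq X Y ≡ true → X ≡ Y
subsetEq-sound {X = X} {Y} p = toWitness {a? = ≡-dec _≟ᵇ_ X Y} (Equivalence.from T-≡ p)

subsetEq-complete : ∀ {X Y : Subset n} → X ≡ Y → subsetEq X Y ≡ true
subsetEq-complete {X = X} {Y} p = Equivalence.to T-≡ (fromWitness {a? = ≡-dec _≟ᵇ_ X Y} p)

finEq-sound : ∀ {i j : Fin n} → finEq i j ≡ true → i ≡ j
finEq-sound {i = i} {j} p = toWitness {a? = i ≟ᶠ j} (Equivalence.from T-≡ p)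

anyF-sound : ∀ {f : Fin n → Bool} → anyF f ≡ true → ∃ λ i → f i ≡ true
anyF-sound {suc n} {f} p with f zero in e
... | true  = zero , e
... | false = let i , q = anyF-sound p in suc i , q

anyF-complete : ∀ {f : Fin n → Bool} i → f i ≡ true → anyF f ≡ true
anyF-complete zero p rewrite p = refl
anyF-complete {f = f} (suc i) p rewrite anyF-complete {f = f ∘ suc} i p = ∨-zeroʳ (f zero)

allF-sound : ∀ {f : Fin n → Bool} → allF f ≡ true → ∀ i → f i ≡ true
allF-sound p zero    = ∧-conicalˡ _ _ p
allF-sound p (suc i) = allF-sound (∧-conicalʳ _ _ p) i

∈-tabulate⁺ : ∀ {f : Fin n → Bool} {i} → f i ≡ true → i ∈ tabulate f
∈-tabulate⁺ {f = f} {i} p = lookup⇒[]= i (tabulate f) (trans (lookup∘tabulate f i) p)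

∈-tabulate⁻ : ∀ {f : Fin n → Bool} {i} → i ∈ tabulate f → f i ≡ true
∈-tabulate⁻ {f = f} {i} m = trans (sym (lookup∘tabulate f i)) ([]=⇒lookup m)

∣p∪q∣≤∣p∣+∣q∣ : ∀ (p q : Subset n) → ∣ p ∪ q ∣ ≤ ∣ p ∣ + ∣ q ∣
∣p∪q∣≤∣p∣+∣q∣ []          []          = z≤n
∣p∪q∣≤∣p∣+∣q∣ (true ∷ p)  (true ∷ q)  =
  s≤s (≤-trans (∣p∪q∣≤∣p∣+∣q∣ p q) (+-monoʳ-≤ ∣ p ∣ (n≤1+n ∣ q ∣)))
∣p∪q∣≤∣p∣+∣q∣ (true ∷ p)  (false ∷ q) = s≤s (∣p∪q∣≤∣p∣+∣q∣ p q)
∣p∪q∣≤∣p∣+∣q∣ (false ∷ p) (true ∷ q)  =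
  ≤-trans (s≤s (∣p∪q∣≤∣p∣+∣q∣ p q)) (≤-reflexive (sym (+-suc ∣ p ∣ ∣ q ∣)))
∣p∪q∣≤∣p∣+∣q∣ (false ∷ p) (false ∷ q) = ∣p∪q∣≤∣p∣+∣q∣ p q

x∈p⇒0<∣p∣ : ∀ {p : Subset n} {x} → x ∈ p → 1 ≤ ∣ p ∣
x∈p⇒0<∣p∣ x∈p = ≤-trans (s≤s z≤n) (x∈p⇒∣p-x∣<∣p∣ x∈p)

x≢y∈p⇒1<∣p∣ : ∀ {p : Subset n} {x y} → x ∈ p → y ∈ p → x ≢ y → 2 ≤ ∣ p ∣
x≢y∈p⇒1<∣p∣ x∈p y∈p x≢y =
  ≤-trans (s≤s (x∈p⇒0<∣p∣ (x∈p∧x≢y⇒x∈p-y y∈p (≢-sym x≢y)))) (x∈p⇒∣p-x∣<∣p∣ x∈p)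

W : Graph a b → Fin a → Subset a
W E x = nbr2 E R ─ (R ∪ sisters E R)
  where R = twinClass E x

Distinguishes : Graph a b → Fin a → Fin a → Set
Distinguishes E x w = ∃ λ y → E x y ≢ E w y

CommonNeighbour : Graph a b → Fin a → Fin a → Set
CommonNeighbour E x w = ∃ λ y → E x y ≡ true × E w y ≡ true

HasTwin : Graph a b → Fin a → Set
HasTwin E w = ∃ λ w′ → w′ ≢ w × (∀ y → E w′ y ≡ E w y)

-- Each disjunct violates one clause of "w is a sister of the twin class of x":
-- having no twin, or N(w) = N(x) ∪ {v}.
NonSister : Graph a b → Fin a → Fin a → Set
NonSister E x w =
  HasTwin E w ⊎
  (∃ λ y → E x y ≡ true × E w y ≡ false) ⊎
  (∃₂ λ v₁ v₂ → v₁ ≢ v₂ × (E x v₁ ≡ false × E w v₁ ≡ true) × (E x v₂ ≡ false × E w v₂ ≡ true))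

InW : Graph a b → Fin a → Fin a → Set
InW E x w = CommonNeighbour E x w × Distinguishes E x w × NonSister E x w

-- A certificate, checkable inside the component of x, that |R| ≤ |W| for
-- the twin class R of x: R ⊆ {x, x̃}, and W contains w₁ and w₂, which are
-- distinct unless x̃ = x.
LocallyIrreducible : Graph a b → Fin a → Set
LocallyIrreducible E x =
  ∃ λ x̃ → (∀ x′ → x′ ≡ x ⊎ x′ ≡ x̃ ⊎ Distinguishes E x x′) ×
          ∃₂ λ w₁ w₂ → InW E x w₁ × InW E x w₂ × (x ≡ x̃ ⊎ w₁ ≢ w₂)

Irreducible : Graph a b → Set
Irreducible E = (∀ x → LocallyIrreducible E x) × (∀ y → LocallyIrreducible (transposeG E) y)

module _ (E : Graph a b) where

  twins⇒∈twinClass : ∀ {x x′} → (∀ y → E x′ y ≡ E x y) → x′ ∈ twinClass E x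
  twins⇒∈twinClass twins = ∈-tabulate⁺ (subsetEq-complete (tabulate-cong twins))

  ∈twinClass⇒twins : ∀ {x x′} → x′ ∈ twinClass E x → ∀ y → E x′ y ≡ E x y
  ∈twinClass⇒twins {x} {x′} x′∈R y = begin
    E x′ y                 ≡⟨ lookup∘tabulate (E x′) y ⟨
    lookup (nbr E x′) y    ≡⟨ cong (λ s → lookup s y) (subsetEq-sound (∈-tabulate⁻ x′∈R)) ⟩
    lookup (nbr E x) y     ≡⟨ lookup∘tabulate (E x) y ⟩
    E x y                  ∎
    where open ≡-Reasoning

  nbrSet-twinClass : ∀ x → nbrSet E (twinClass E x) ≡ nbr E x
  nbrSet-twinClass x = tabulate-cong λ y → ⇔→≡ (mk⇔ (into y) (onto y))
    where
    R = twinClass E x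
    into : ∀ y → anyF (λ x′ → lookup R x′ ∧ E x′ y) ≡ true → E x y ≡ true
    into y p = let x′ , q = anyF-sound p in
      trans (sym (∈twinClass⇒twins (lookup⇒[]= x′ R (∧-conicalˡ _ _ q)) y)) (∧-conicalʳ _ _ q)
    onto : ∀ y → E x y ≡ true → anyF (λ x′ → lookup R x′ ∧ E x′ y) ≡ true
    onto y p = anyF-complete x (cong₂ _∧_ ([]=⇒lookup (twins⇒∈twinClass (λ _ → refl))) p)

  noTwin⇒¬HasTwin : ∀ {w} → noTwin E w ≡ true → ¬ HasTwin E w
  noTwin⇒¬HasTwin noTwin (w′ , w′≢w , twins) with ∨≡true⁻ (allF-sound noTwin w′)
  ... | inj₁ w′≡w = w′≢w (finEq-sound w′≡w)
  ... | inj₂ notTwins =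
    contradiction (trans (cong not (sym (subsetEq-complete (tabulate-cong twins)))) notTwins) λ ()

  ∈sisters⇒ : ∀ {x w} → w ∈ sisters E (twinClass E x) →
              ¬ HasTwin E w × ∃ λ v → nbr E w ≡ nbr E x ∪ ⁅ v ⁆
  ∈sisters⇒ {x} {w} w∈T =
    noTwin⇒¬HasTwin (∧-conicalˡ _ _ candidate) , map₂ shape (anyF-sound (∧-conicalʳ _ _ candidate))
    where
    R = twinClass E x
    S = nbrSet E R
    candidate : noTwin E w ∧ anyF (λ v → not (lookup S v) ∧ subsetEq (nbr E w) (S ∪ ⁅ v ⁆)) ≡ true
    candidate = ∧-conicalʳ (not (lookup R w)) _
      (∧-conicalʳ (lookup (nbr2 E R) w) _ (∈-tabulate⁻ {f = isSister E R} w∈T))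
    shape : ∀ {v} → not (lookup S v) ∧ subsetEq (nbr E w) (S ∪ ⁅ v ⁆) ≡ true → nbr E w ≡ nbr E x ∪ ⁅ v ⁆
    shape {v} p = trans (subsetEq-sound (∧-conicalʳ _ _ p)) (cong (_∪ ⁅ v ⁆) (nbrSet-twinClass x))

  NonSister⇒∉sisters : ∀ {x w} → NonSister E x w → w ∉ sisters E (twinClass E x)
  NonSister⇒∉sisters {x} {w} nonSister w∈T with ∈sisters⇒ w∈T | nonSister
  ... | noTwin , _ , _     | inj₁ twin = noTwin twin
  ... | _      , v , nbrW | inj₂ (inj₁ (y , xy , wy)) =
    ≡true≢≡false (∈-tabulate⁻ (subst (y ∈_) (sym nbrW) (x∈p∪q⁺ (inj₁ (∈-tabulate⁺ xy))))) wy refl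
  ... | _      , v , nbrW | inj₂ (inj₂ (v₁ , v₂ , v₁≢v₂ , new₁ , new₂)) =
    v₁≢v₂ (trans (is-v new₁) (sym (is-v new₂)))
    where
    is-v : ∀ {u} → E x u ≡ false × E w u ≡ true → u ≡ v
    is-v (xu , wu) with x∈p∪q⁻ _ _ (subst (_ ∈_) nbrW (∈-tabulate⁺ wu))
    ... | inj₁ u∈Nx  = contradiction refl (≡true≢≡false (∈-tabulate⁻ u∈Nx) xu)
    ... | inj₂ u∈⁅v⁆ = x∈⁅y⁆⇒x≡y v u∈⁅v⁆

  InW⇒∈W : ∀ {x w} → InW E x w → w ∈ W E x
  InW⇒∈W {x} {w} ((c , xc , wc) , (y , xy≢wy) , nonSister) =
    x∈p∧x∉q⇒x∈p─q w∈N²R ([ w∉R , NonSister⇒∉sisters nonSister ] ∘ x∈p∪q⁻ _ _)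
    where
    w∈N²R : w ∈ nbr2 E (twinClass E x)
    w∈N²R = ∈-tabulate⁺ (anyF-complete c (cong₂ _∧_ c∈S wc))
      where
      c∈S = trans (cong (λ s → lookup s c) (nbrSet-twinClass x)) (trans (lookup∘tabulate (E x) c) xc)
    w∉R : w ∉ twinClass E x
    w∉R w∈R = xy≢wy (sym (∈twinClass⇒twins w∈R y))

  twinClass⊆ : ∀ {x x̃} → (∀ x′ → x′ ≡ x ⊎ x′ ≡ x̃ ⊎ Distinguishes E x x′) →
               twinClass E x ⊆ ⁅ x ⁆ ∪ ⁅ x̃ ⁆
  twinClass⊆ classify {x′} x′∈R with classify x′
  ... | inj₁ refl              = x∈p∪q⁺ (inj₁ (x∈⁅x⁆ x′))
  ... | inj₂ (inj₁ refl)       = x∈p∪q⁺ (inj₂ (x∈⁅x⁆ x′))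
  ... | inj₂ (inj₂ (y , x≢x′)) = contradiction (sym (∈twinClass⇒twins x′∈R y)) x≢x′

  ∣twinClass∣≤∣W∣ : ∀ {x} → LocallyIrreducible E x → ∣ twinClass E x ∣ ≤ ∣ W E x ∣
  ∣twinClass∣≤∣W∣ {x} (x̃ , classify , w₁ , w₂ , inW₁ , inW₂ , x≡x̃⊎w₁≢w₂) with x≡x̃⊎w₁≢w₂
  ... | inj₁ refl = begin
    ∣ twinClass E x ∣    ≤⟨ p⊆q⇒∣p∣≤∣q∣ (twinClass⊆ classify) ⟩
    ∣ ⁅ x ⁆ ∪ ⁅ x ⁆ ∣    ≡⟨ cong ∣_∣ (∪-idem ⁅ x ⁆) ⟩
    ∣ ⁅ x ⁆ ∣            ≡⟨ ∣⁅x⁆∣≡1 x ⟩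
    1                    ≤⟨ x∈p⇒0<∣p∣ (InW⇒∈W inW₁) ⟩
    ∣ W E x ∣            ∎
    where open ≤-Reasoning
  ... | inj₂ w₁≢w₂ = begin
    ∣ twinClass E x ∣        ≤⟨ p⊆q⇒∣p∣≤∣q∣ (twinClass⊆ classify) ⟩
    ∣ ⁅ x ⁆ ∪ ⁅ x̃ ⁆ ∣        ≤⟨ ∣p∪q∣≤∣p∣+∣q∣ ⁅ x ⁆ ⁅ x̃ ⁆ ⟩
    ∣ ⁅ x ⁆ ∣ + ∣ ⁅ x̃ ⁆ ∣    ≡⟨ cong₂ _+_ (∣⁅x⁆∣≡1 x) (∣⁅x⁆∣≡1 x̃) ⟩
    2                        ≤⟨ x≢y∈p⇒1<∣p∣ (InW⇒∈W inW₁) (InW⇒∈W inW₂) w₁≢w₂ ⟩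
    ∣ W E x ∣                ∎
    where open ≤-Reasoning

  ∣W∣≤∣N²R─R∣ : ∀ x → let R = twinClass E x in ∣ W E x ∣ ≤ ∣ nbr2 E R ─ R ∣
  ∣W∣≤∣N²R─R∣ x =
    subst (_≤ ∣ N²R ─ R ∣) (cong ∣_∣ (p─q─r≡p─q∪r N²R R T)) (∣p─q∣≤∣p∣ (N²R ─ R) T)
    where
    R = twinClass E x
    N²R = nbr2 E R
    T = sisters E R

  ¬Rule2₁ : (∀ x → LocallyIrreducible E x) → ¬ Rule2₁ E
  ¬Rule2₁ irreducible (x , ∣N²R─R∣<∣R∣) =
    ≤⇒≯ (≤-trans (∣twinClass∣≤∣W∣ (irreducible x)) (∣W∣≤∣N²R─R∣ x)) ∣N²R─R∣<∣R∣

  ¬Rule3₁ : (∀ x → LocallyIrreducible E x) → ¬ Rule3₁ E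
  ¬Rule3₁ irreducible (x , ∣W∣<∣R∣ , _) = ≤⇒≯ (∣twinClass∣≤∣W∣ (irreducible x)) ∣W∣<∣R∣

  nonTwinNeighbour : ∀ {x} → LocallyIrreducible E x → ∃ λ w → CommonNeighbour E x w × Distinguishes E x w
  nonTwinNeighbour (_ , _ , w , _ , (common , distinct , _) , _) = w , common , distinct

edge₁₂ : ∀ {E : Graph a b} {x y} → E x y ≡ true → Reach E (inj₁ x) (inj₂ y)
edge₁₂ e = e ◅ ε

edge₂₁ : ∀ {E : Graph a b} {x y} → E x y ≡ true → Reach E (inj₂ y) (inj₁ x)
edge₂₁ e = e ◅ ε

-- A vertex sharing a neighbour with x lies in the component of x; if that
-- component were a bicluster, it would be a twin of x.
¬Rule1 : ∀ {E : Graph a b} → Irreducible E → ¬ Rule1 E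
¬Rule1 {E = E} (irr₁ , _) (inj₁ x , bicluster , _) with nonTwinNeighbour E (irr₁ x)
... | w , (c , xc , wc) , (y , xy≢wy) =
  xy≢wy (⇔→≡ (⇔.trans (bicluster x ε y) (⇔.sym (bicluster w (edge₁₂ xc ◅◅ edge₂₁ wc) y))))
¬Rule1 {E = E} (_ , irr₂) (inj₂ y , _ , bicluster) with nonTwinNeighbour (transposeG E) (irr₂ y)
... | w , (c , cy , cw) , (x , xy≢xw) =
  xy≢xw (⇔→≡ (⇔.trans (bicluster y ε x) (⇔.sym (bicluster w (edge₂₁ cy ◅◅ edge₁₂ cw) x))))

¬Rule2 : ∀ {E : Graph a b} → Irreducible E → ¬ Rule2 E
¬Rule2 {E = E} (irr₁ , irr₂) = [ ¬Rule2₁ E irr₁ , ¬Rule2₁ (transposeG E) irr₂ ]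

¬Rule3 : ∀ {E : Graph a b} → Irreducible E → ¬ Rule3 E
¬Rule3 {E = E} (irr₁ , irr₂) = [ ¬Rule3₁ E irr₁ , ¬Rule3₁ (transposeG E) irr₂ ]

module _ (E : Graph a b) where

  distinguishes? : ∀ x w → Dec (Distinguishes E x w)
  distinguishes? x w = any? λ y → ¬? (E x y ≟ᵇ E w y)

  inW? : ∀ x w → Dec (InW E x w)
  inW? x w = common? ×-dec distinguishes? x w ×-dec nonSister?
    where
    new? : ∀ v → Dec (E x v ≡ false × E w v ≡ true)
    new? v = (E x v ≟ᵇ false) ×-dec (E w v ≟ᵇ true)
    common? = any? λ y → (E x y ≟ᵇ true) ×-dec (E w y ≟ᵇ true)
    nonSister? =
      (any? λ w′ → ¬? (w′ ≟ᶠ w) ×-dec all? λ y → E w′ y ≟ᵇ E w y) ⊎-dec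
      (any? λ y → (E x y ≟ᵇ true) ×-dec (E w y ≟ᵇ false)) ⊎-dec
      (any? λ v₁ → any? λ v₂ → ¬? (v₁ ≟ᶠ v₂) ×-dec new? v₁ ×-dec new? v₂)

  locallyIrreducible? : ∀ x → Dec (LocallyIrreducible E x)
  locallyIrreducible? x =
    any? λ x̃ → (all? λ x′ → (x′ ≟ᶠ x) ⊎-dec (x′ ≟ᶠ x̃) ⊎-dec distinguishes? x x′) ×-dec
               (any? λ w₁ → any? λ w₂ → inW? x w₁ ×-dec inW? x w₂ ×-dec ((x ≟ᶠ x̃) ⊎-dec ¬? (w₁ ≟ᶠ w₂)))

irreducible? : (E : Graph a b) → Dec (Irreducible E)
irreducible? E = all? (locallyIrreducible? E) ×-dec all? (locallyIrreducible? (transposeG E))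

record ComponentEmbedding (E₁ : Graph a b) (E : Graph a′ b′) : Set where
  field
    f₁ : Fin a → Fin a′
    f₂ : Fin b → Fin b′
    f₁-injective : Injective _≡_ _≡_ f₁
    f₂-injective : Injective _≡_ _≡_ f₂
    edge : ∀ i j → E (f₁ i) (f₂ j) ≡ E₁ i j
    closed₁ : ∀ x → (∃ λ i → f₁ i ≡ x) ⊎ (∀ j → E x (f₂ j) ≡ false)
    closed₂ : ∀ y → (∃ λ j → f₂ j ≡ y) ⊎ (∀ i → E (f₁ i) y ≡ false)

transpose-embedding : ∀ {E₁ : Graph a b} {E : Graph a′ b′} →
  ComponentEmbedding E₁ E → ComponentEmbedding (transposeG E₁) (transposeG E)
transpose-embedding M = record
  { f₁ = f₂ ; f₂ = f₁ ; f₁-injective = f₂-injective ; f₂-injective = f₁-injective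
  ; edge = λ j i → edge i j ; closed₁ = closed₂ ; closed₂ = closed₁ }
  where open ComponentEmbedding M

module _ {E₁ : Graph a b} {E : Graph a′ b′} (M : ComponentEmbedding E₁ E) where
  open ComponentEmbedding M

  edge-lift : ∀ {i j u} → E₁ i j ≡ u → E (f₁ i) (f₂ j) ≡ u
  edge-lift = trans (edge _ _)

  distinguishes-lift : ∀ {i w} → Distinguishes E₁ i w → Distinguishes E (f₁ i) (f₁ w)
  distinguishes-lift {i} {w} (y , iy≢wy) =
    f₂ y , λ eq → iy≢wy (trans (sym (edge i y)) (trans eq (edge w y)))

  twins-lift : ∀ {i w} → (∀ j → E₁ w j ≡ E₁ i j) → ∀ y → E (f₁ w) y ≡ E (f₁ i) y
  twins-lift {i} {w} twins y with closed₂ y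
  ... | inj₁ (j , refl) = trans (edge w j) (trans (twins j) (sym (edge i j)))
  ... | inj₂ isolated   = trans (isolated w) (sym (isolated i))

  nonSister-lift : ∀ {i w} → NonSister E₁ i w → NonSister E (f₁ i) (f₁ w)
  nonSister-lift (inj₁ (w′ , w′≢w , twins)) = inj₁ (f₁ w′ , w′≢w ∘ f₁-injective , twins-lift twins)
  nonSister-lift (inj₂ (inj₁ (y , iy , wy))) = inj₂ (inj₁ (f₂ y , edge-lift iy , edge-lift wy))
  nonSister-lift (inj₂ (inj₂ (v₁ , v₂ , v₁≢v₂ , (iv₁ , wv₁) , (iv₂ , wv₂)))) =
    inj₂ (inj₂ (f₂ v₁ , f₂ v₂ , v₁≢v₂ ∘ f₂-injective ,
                (edge-lift iv₁ , edge-lift wv₁) , (edge-lift iv₂ , edge-lift wv₂)))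

  inW-lift : ∀ {i w} → InW E₁ i w → InW E (f₁ i) (f₁ w)
  inW-lift ((c , ic , wc) , distinct , nonSister) =
    (f₂ c , edge-lift ic , edge-lift wc) , distinguishes-lift distinct , nonSister-lift nonSister

  locallyIrreducible-lift : ∀ {i} → LocallyIrreducible E₁ i → LocallyIrreducible E (f₁ i)
  locallyIrreducible-lift {i} (ĩ , classify , w₁ , w₂ , inW₁@((c , ic , _) , _) , inW₂ , i≡ĩ⊎w₁≢w₂) =
    f₁ ĩ , classify′ , f₁ w₁ , f₁ w₂ , inW-lift inW₁ , inW-lift inW₂ ,
    Sum.map (cong f₁) (_∘ f₁-injective) i≡ĩ⊎w₁≢w₂
    where
    classify′ : ∀ x → x ≡ f₁ i ⊎ x ≡ f₁ ĩ ⊎ Distinguishes E (f₁ i) x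
    classify′ x with closed₁ x
    ... | inj₁ (i′ , refl) = Sum.map (cong f₁) (Sum.map (cong f₁) distinguishes-lift) (classify i′)
    ... | inj₂ isolated    =
      inj₂ (inj₂ (f₂ c , ≡true≢≡false (edge-lift ic) (isolated c)))

_⊎ᴳ_ : Graph a b → Graph c d → (Fin a ⊎ Fin c) → (Fin b ⊎ Fin d) → Bool
(E₁ ⊎ᴳ E₂) (inj₁ i) (inj₁ j) = E₁ i j
(E₁ ⊎ᴳ E₂) (inj₂ i) (inj₂ j) = E₂ i j
(E₁ ⊎ᴳ E₂) (inj₁ _) (inj₂ _) = false
(E₁ ⊎ᴳ E₂) (inj₂ _) (inj₁ _) = false

_⊕_ : Graph a b → Graph c d → Graph (a + c) (b + d)
_⊕_ {a} {b} E₁ E₂ x y = (E₁ ⊎ᴳ E₂) (splitAt a x) (splitAt b y)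

↑-cases : ∀ a (x : Fin (a + c)) → (∃ λ i → i ↑ˡ c ≡ x) ⊎ (∃ λ j → a ↑ʳ j ≡ x)
↑-cases a x with splitAt a x in eq
... | inj₁ i = inj₁ (i , splitAt⁻¹-↑ˡ eq)
... | inj₂ j = inj₂ (j , splitAt⁻¹-↑ʳ eq)

module _ {a b c d} (E₁ : Graph a b) (E₂ : Graph c d) where

  ⊕-↑ˡ↑ˡ : ∀ i j → (E₁ ⊕ E₂) (i ↑ˡ c) (j ↑ˡ d) ≡ E₁ i j
  ⊕-↑ˡ↑ˡ i j rewrite splitAt-↑ˡ a i c | splitAt-↑ˡ b j d = refl

  ⊕-↑ˡ↑ʳ : ∀ i j → (E₁ ⊕ E₂) (i ↑ˡ c) (b ↑ʳ j) ≡ false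
  ⊕-↑ˡ↑ʳ i j rewrite splitAt-↑ˡ a i c | splitAt-↑ʳ b d j = refl

  ⊕-↑ʳ↑ˡ : ∀ i j → (E₁ ⊕ E₂) (a ↑ʳ i) (j ↑ˡ d) ≡ false
  ⊕-↑ʳ↑ˡ i j rewrite splitAt-↑ʳ a c i | splitAt-↑ˡ b j d = refl

  ⊕-↑ʳ↑ʳ : ∀ i j → (E₁ ⊕ E₂) (a ↑ʳ i) (b ↑ʳ j) ≡ E₂ i j
  ⊕-↑ʳ↑ʳ i j rewrite splitAt-↑ʳ a c i | splitAt-↑ʳ b d j = refl

  ↑ˡ-embedding : ComponentEmbedding E₁ (E₁ ⊕ E₂)
  ↑ˡ-embedding = record
    { f₁ = _↑ˡ c ; f₂ = _↑ˡ d
    ; f₁-injective = ↑ˡ-injective c _ _ ; f₂-injective = ↑ˡ-injective d _ _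
    ; edge = ⊕-↑ˡ↑ˡ ; closed₁ = closed₁ ; closed₂ = closed₂ }
    where
    closed₁ : ∀ x → (∃ λ i → i ↑ˡ c ≡ x) ⊎ (∀ j → (E₁ ⊕ E₂) x (j ↑ˡ d) ≡ false)
    closed₁ x with ↑-cases a x
    ... | inj₁ left         = inj₁ left
    ... | inj₂ (i , refl)   = inj₂ (⊕-↑ʳ↑ˡ i)
    closed₂ : ∀ y → (∃ λ j → j ↑ˡ d ≡ y) ⊎ (∀ i → (E₁ ⊕ E₂) (i ↑ˡ c) y ≡ false)
    closed₂ y with ↑-cases b y
    ... | inj₁ left         = inj₁ left
    ... | inj₂ (j , refl)   = inj₂ (λ i → ⊕-↑ˡ↑ʳ i j)

  ↑ʳ-embedding : ComponentEmbedding E₂ (E₁ ⊕ E₂)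
  ↑ʳ-embedding = record
    { f₁ = a ↑ʳ_ ; f₂ = b ↑ʳ_
    ; f₁-injective = ↑ʳ-injective a _ _ ; f₂-injective = ↑ʳ-injective b _ _
    ; edge = ⊕-↑ʳ↑ʳ ; closed₁ = closed₁ ; closed₂ = closed₂ }
    where
    closed₁ : ∀ x → (∃ λ i → a ↑ʳ i ≡ x) ⊎ (∀ j → (E₁ ⊕ E₂) x (b ↑ʳ j) ≡ false)
    closed₁ x with ↑-cases a x
    ... | inj₁ (i , refl)   = inj₂ (⊕-↑ˡ↑ʳ i)
    ... | inj₂ right        = inj₁ right
    closed₂ : ∀ y → (∃ λ j → b ↑ʳ j ≡ y) ⊎ (∀ i → (E₁ ⊕ E₂) (a ↑ʳ i) y ≡ false)
    closed₂ y with ↑-cases b y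
    ... | inj₁ (j , refl)   = inj₂ (λ i → ⊕-↑ʳ↑ˡ i j)
    ... | inj₂ right        = inj₁ right

  Irreducible-⊕ : Irreducible E₁ → Irreducible E₂ → Irreducible (E₁ ⊕ E₂)
  Irreducible-⊕ (irr₁ , irrᵀ₁) (irr₂ , irrᵀ₂) = irr , irrᵀ
    where
    irr : ∀ x → LocallyIrreducible (E₁ ⊕ E₂) x
    irr x with ↑-cases a x
    ... | inj₁ (i , refl) = locallyIrreducible-lift ↑ˡ-embedding (irr₁ i)
    ... | inj₂ (i , refl) = locallyIrreducible-lift ↑ʳ-embedding (irr₂ i)
    irrᵀ : ∀ y → LocallyIrreducible (transposeG (E₁ ⊕ E₂)) y
    irrᵀ y with ↑-cases b y
    ... | inj₁ (j , refl) = locallyIrreducible-lift (transpose-embedding ↑ˡ-embedding) (irrᵀ₁ j)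
    ... | inj₂ (j , refl) = locallyIrreducible-lift (transpose-embedding ↑ʳ-embedding) (irrᵀ₂ j)

P4Free : Graph a b → Set
P4Free B = ∀ x₁ y₁ x₂ y₂ → B x₁ y₁ ≡ true → B x₂ y₁ ≡ true → B x₂ y₂ ≡ true → B x₁ y₂ ≡ true

P4Free? : (B : Graph a b) → Dec (P4Free B)
P4Free? B = all? λ x₁ → all? λ y₁ → all? λ x₂ → all? λ y₂ →
  (B x₁ y₁ ≟ᵇ true) →-dec (B x₂ y₁ ≟ᵇ true) →-dec (B x₂ y₂ ≟ᵇ true) →-dec (B x₁ y₂ ≟ᵇ true)

biclusterGraph⇒P4Free : ∀ {B : Graph a b} → IsBiclusterGraph B → P4Free B
biclusterGraph⇒P4Free bicluster x₁ y₁ x₂ y₂ e₁ e₂ e₃ =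
  Equivalence.from (proj₁ (bicluster (inj₁ x₁)) x₁ ε y₂) (edge₁₂ e₁ ◅◅ edge₂₁ e₂ ◅◅ edge₁₂ e₃)

module _ {B : Graph a b} (p4 : P4Free B) where

  private
    -- what a path ending in inj₁ x says about its start
    Near : Vtx a b → Fin a → Set
    Near (inj₂ y)  x = B x y ≡ true
    Near (inj₁ x′) x = x′ ≡ x ⊎ ∃ λ y → B x y ≡ true × B x′ y ≡ true

    near : ∀ {u x} → Reach B u (inj₁ x) → Near u x
    near ε = inj₁ refl
    near {inj₁ x′} (_◅_ {j = inj₂ y} e path) = inj₂ (y , near path , e)
    near {inj₂ y}  (_◅_ {j = inj₁ x′} e path) with near path
    ... | inj₁ refl          = e
    ... | inj₂ (y₀ , p , q)  = p4 _ y₀ x′ y p q e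
    near {inj₁ _} (_◅_ {j = inj₁ _} () _)
    near {inj₂ _} (_◅_ {j = inj₂ _} () _)

    Adj-sym : ∀ {u v} → Adj B u v → Adj B v u
    Adj-sym {inj₁ _} {inj₂ _} e = e
    Adj-sym {inj₂ _} {inj₁ _} e = e

  reach⇒adjacent : ∀ {v x y} → Reach B v (inj₁ x) → Reach B v (inj₂ y) → B x y ≡ true
  reach⇒adjacent vx vy = near (reverse Adj-sym vy ◅◅ vx)

  P4Free⇒biclusterGraph : IsBiclusterGraph B
  P4Free⇒biclusterGraph v =
    (λ x vx y → mk⇔ (λ e → vx ◅◅ edge₁₂ e) (reach⇒adjacent vx)) ,
    (λ y vy x → mk⇔ (λ e → vy ◅◅ edge₂₁ e) (λ vx → reach⇒adjacent vx vy))

P4Free-⊎ᴳ : ∀ {B₁ : Graph a b} {B₂ : Graph c d} → P4Free B₁ → P4Free B₂ →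
  ∀ x₁ y₁ x₂ y₂ → let B = B₁ ⊎ᴳ B₂ in
  B x₁ y₁ ≡ true → B x₂ y₁ ≡ true → B x₂ y₂ ≡ true → B x₁ y₂ ≡ true
P4Free-⊎ᴳ p₁ p₂ (inj₁ x₁) (inj₁ y₁) (inj₁ x₂) (inj₁ y₂) = p₁ x₁ y₁ x₂ y₂
P4Free-⊎ᴳ p₁ p₂ (inj₂ x₁) (inj₂ y₁) (inj₂ x₂) (inj₂ y₂) = p₂ x₁ y₁ x₂ y₂
P4Free-⊎ᴳ p₁ p₂ (inj₁ _) (inj₂ _) _        _        ()
P4Free-⊎ᴳ p₁ p₂ (inj₂ _) (inj₁ _) _        _        ()
P4Free-⊎ᴳ p₁ p₂ (inj₁ _) (inj₁ _) (inj₂ _) _        _ ()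
P4Free-⊎ᴳ p₁ p₂ (inj₂ _) (inj₂ _) (inj₁ _) _        _ ()
P4Free-⊎ᴳ p₁ p₂ (inj₁ _) (inj₁ _) (inj₁ _) (inj₂ _) _ _ ()
P4Free-⊎ᴳ p₁ p₂ (inj₂ _) (inj₂ _) (inj₂ _) (inj₁ _) _ _ ()

P4Free-⊕ : ∀ {B₁ : Graph a b} {B₂ : Graph c d} → P4Free B₁ → P4Free B₂ → P4Free (B₁ ⊕ B₂)
P4Free-⊕ {a} {b} p₁ p₂ x₁ y₁ x₂ y₂ =
  P4Free-⊎ᴳ p₁ p₂ (splitAt a x₁) (splitAt b y₁) (splitAt a x₂) (splitAt b y₂)

edit : Bool → Bool → ℕ
edit u v = if u xor v then 1 else 0

edit-≢ : ∀ {u v} → u ≢ v → 1 ≤ edit u v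
edit-≢ {true}  {true}  u≢v = contradiction refl u≢v
edit-≢ {true}  {false} _   = s≤s z≤n
edit-≢ {false} {true}  _   = s≤s z≤n
edit-≢ {false} {false} u≢v = contradiction refl u≢v

sumF-cong : ∀ {f g : Fin n → ℕ} → (∀ i → f i ≡ g i) → sumF f ≡ sumF g
sumF-cong {zero}  _   = refl
sumF-cong {suc n} f≗g = cong₂ _+_ (f≗g zero) (sumF-cong (f≗g ∘ suc))

sumF-zero : ∀ {f : Fin n → ℕ} → (∀ i → f i ≡ 0) → sumF f ≡ 0
sumF-zero {zero}  _   = refl
sumF-zero {suc n} f≗0 = cong₂ _+_ (f≗0 zero) (sumF-zero (f≗0 ∘ suc))

sumF-+ : ∀ (f g : Fin n → ℕ) → sumF (λ i → f i + g i) ≡ sumF f + sumF g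
sumF-+ {zero}  f g = refl
sumF-+ {suc n} f g =
  trans (cong (f zero + g zero +_) (sumF-+ (f ∘ suc) (g ∘ suc)))
        (interchange (f zero) (g zero) (sumF (f ∘ suc)) (sumF (g ∘ suc)))

sumF-↑ : ∀ a (f : Fin (a + c) → ℕ) → sumF f ≡ sumF (λ i → f (i ↑ˡ c)) + sumF (λ j → f (a ↑ʳ j))
sumF-↑ zero    f = refl
sumF-↑ {c = c} (suc a) f =
  trans (cong (f zero +_) (sumF-↑ a (f ∘ suc)))
        (sym (+-assoc (f zero) (sumF (λ i → f (suc (i ↑ˡ c)))) (sumF (λ j → f (suc (a ↑ʳ j))))))

sumF-one : ∀ (f : Fin n → ℕ) i → f i ≤ sumF f
sumF-one f zero    = m≤m+n _ _
sumF-one f (suc i) = ≤-trans (sumF-one (f ∘ suc) i) (m≤n+m _ _)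

sumF-two : ∀ (f : Fin n → ℕ) {i j} → i ≢ j → f i + f j ≤ sumF f
sumF-two f {zero}  {zero}  i≢j = contradiction refl i≢j
sumF-two f {zero}  {suc j} _   = +-monoʳ-≤ (f zero) (sumF-one (f ∘ suc) j)
sumF-two f {suc i} {zero}  _   =
  ≤-trans (≤-reflexive (+-comm (f (suc i)) (f zero))) (+-monoʳ-≤ (f zero) (sumF-one (f ∘ suc) i))
sumF-two f {suc i} {suc j} i≢j = ≤-trans (sumF-two (f ∘ suc) (i≢j ∘ cong suc)) (m≤n+m _ _)

sumF² : (Fin a → Fin b → ℕ) → ℕ
sumF² h = sumF (λ x → sumF (h x))

sumF²-blocks : ∀ (h : Fin (a + c) → Fin (b + d) → ℕ) →
  sumF² h ≡ (sumF² (λ i j → h (i ↑ˡ c) (j ↑ˡ d)) + sumF² (λ i j → h (i ↑ˡ c) (b ↑ʳ j)))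
          + (sumF² (λ i j → h (a ↑ʳ i) (j ↑ˡ d)) + sumF² (λ i j → h (a ↑ʳ i) (b ↑ʳ j)))
sumF²-blocks {a = a} {c = c} {b = b} {d = d} h =
  trans (sumF-↑ a (λ x → sumF (h x))) (cong₂ _+_ (split-rows (h ∘ (_↑ˡ c))) (split-rows (h ∘ (a ↑ʳ_))))
  where
  split-rows : ∀ {m} (g : Fin m → Fin (b + d) → ℕ) →
    sumF² g ≡ sumF² (λ i j → g i (j ↑ˡ d)) + sumF² (λ i j → g i (b ↑ʳ j))
  split-rows g = trans (sumF-cong (λ x → sumF-↑ b (g x)))
                       (sumF-+ (λ x → sumF (λ j → g x (j ↑ˡ d))) (λ x → sumF (λ j → g x (b ↑ʳ j))))

sumF²-zero : ∀ {h : Fin a → Fin b → ℕ} → (∀ i j → h i j ≡ 0) → sumF² h ≡ 0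
sumF²-zero h≗0 = sumF-zero λ i → sumF-zero (h≗0 i)

cost-cong : ∀ {E E′ B B′ : Graph a b} → (∀ i j → E i j ≡ E′ i j) → (∀ i j → B i j ≡ B′ i j) →
            cost E B ≡ cost E′ B′
cost-cong E≗E′ B≗B′ = sumF-cong λ i → sumF-cong λ j → cong₂ edit (E≗E′ i j) (B≗B′ i j)

module _ {a b c d} (E₁ : Graph a b) (E₂ : Graph c d) where

  leftBlock : Graph (a + c) (b + d) → Graph a b
  leftBlock B i j = B (i ↑ˡ c) (j ↑ˡ d)

  rightBlock : Graph (a + c) (b + d) → Graph c d
  rightBlock B i j = B (a ↑ʳ i) (b ↑ʳ j)

  P4Free-leftBlock : ∀ {B} → P4Free B → P4Free (leftBlock B)
  P4Free-leftBlock p4 _ _ _ _ = p4 _ _ _ _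

  P4Free-rightBlock : ∀ {B} → P4Free B → P4Free (rightBlock B)
  P4Free-rightBlock p4 _ _ _ _ = p4 _ _ _ _

  edits₁₂ edits₂₁ : Graph (a + c) (b + d) → ℕ
  edits₁₂ B = sumF² λ i j → edit ((E₁ ⊕ E₂) (i ↑ˡ c) (b ↑ʳ j)) (B (i ↑ˡ c) (b ↑ʳ j))
  edits₂₁ B = sumF² λ i j → edit ((E₁ ⊕ E₂) (a ↑ʳ i) (j ↑ˡ d)) (B (a ↑ʳ i) (j ↑ˡ d))

  cost-blocks : ∀ B → cost (E₁ ⊕ E₂) B ≡
    (cost (leftBlock (E₁ ⊕ E₂)) (leftBlock B) + edits₁₂ B) +
    (edits₂₁ B + cost (rightBlock (E₁ ⊕ E₂)) (rightBlock B))
  cost-blocks B = sumF²-blocks {a = a} {c = c} {b = b} {d = d} λ x y → edit ((E₁ ⊕ E₂) x y) (B x y)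

  cost-⊕⊕ : ∀ B₁ B₂ → cost (E₁ ⊕ E₂) (B₁ ⊕ B₂) ≡ cost E₁ B₁ + cost E₂ B₂
  cost-⊕⊕ B₁ B₂ = begin
    cost (E₁ ⊕ E₂) B                     ≡⟨ cost-blocks B ⟩
    (D₁ + edits₁₂ B) + (edits₂₁ B + D₂)
      ≡⟨ cong₂ _+_ (cong₂ _+_ diagonal₁ off₁₂) (cong₂ _+_ off₂₁ diagonal₂) ⟩
    (cost E₁ B₁ + 0) + (0 + cost E₂ B₂)  ≡⟨ cong (_+ cost E₂ B₂) (+-identityʳ (cost E₁ B₁)) ⟩
    cost E₁ B₁ + cost E₂ B₂              ∎
    where
    open ≡-Reasoning
    B = B₁ ⊕ B₂
    D₁ = cost (leftBlock (E₁ ⊕ E₂)) (leftBlock B)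
    D₂ = cost (rightBlock (E₁ ⊕ E₂)) (rightBlock B)
    diagonal₁ = cost-cong (⊕-↑ˡ↑ˡ E₁ E₂) (⊕-↑ˡ↑ˡ B₁ B₂)
    diagonal₂ = cost-cong (⊕-↑ʳ↑ʳ E₁ E₂) (⊕-↑ʳ↑ʳ B₁ B₂)
    off₁₂ = sumF²-zero λ i j → cong₂ edit (⊕-↑ˡ↑ʳ E₁ E₂ i j) (⊕-↑ˡ↑ʳ B₁ B₂ i j)
    off₂₁ = sumF²-zero λ i j → cong₂ edit (⊕-↑ʳ↑ˡ E₁ E₂ i j) (⊕-↑ʳ↑ˡ B₁ B₂ i j)

  cost-⊕-≥ : ∀ B → cost E₁ (leftBlock B) + cost E₂ (rightBlock B) ≤ cost (E₁ ⊕ E₂) B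
  cost-⊕-≥ B = begin
    cost E₁ (leftBlock B) + cost E₂ (rightBlock B)
      ≡⟨ cong₂ _+_ (cost-cong (sym ∘₂ ⊕-↑ˡ↑ˡ E₁ E₂) (λ _ _ → refl))
                   (cost-cong (sym ∘₂ ⊕-↑ʳ↑ʳ E₁ E₂) (λ _ _ → refl)) ⟩
    D₁ + D₂                                  ≤⟨ +-mono-≤ (m≤m+n D₁ (edits₁₂ B)) (m≤n+m D₂ (edits₂₁ B)) ⟩
    (D₁ + edits₁₂ B) + (edits₂₁ B + D₂)      ≡⟨ cost-blocks B ⟨
    cost (E₁ ⊕ E₂) B                         ∎
    where
    open ≤-Reasoning
    D₁ = cost (leftBlock (E₁ ⊕ E₂)) (leftBlock B)
    D₂ = cost (rightBlock (E₁ ⊕ E₂)) (rightBlock B)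

  MinBiclusterCost-⊕ : ∀ {m₁ m₂} → MinBiclusterCost E₁ m₁ → MinBiclusterCost E₂ m₂ →
                       MinBiclusterCost (E₁ ⊕ E₂) (m₁ + m₂)
  MinBiclusterCost-⊕ ((B₁ , bicluster₁ , cost₁) , optimal₁) ((B₂ , bicluster₂ , cost₂) , optimal₂) =
    (B₁ ⊕ B₂ , bicluster , trans (cost-⊕⊕ B₁ B₂) (cong₂ _+_ cost₁ cost₂)) ,
    λ B biclusterB → let p4 = biclusterGraph⇒P4Free biclusterB in
      ≤-trans (+-mono-≤ (optimal₁ (leftBlock B) (P4Free⇒biclusterGraph (P4Free-leftBlock p4)))
                        (optimal₂ (rightBlock B) (P4Free⇒biclusterGraph (P4Free-rightBlock p4))))
              (cost-⊕-≥ B)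
    where
    bicluster = P4Free⇒biclusterGraph
      (P4Free-⊕ (biclusterGraph⇒P4Free bicluster₁) (biclusterGraph⇒P4Free bicluster₂))

module _ (E B : Graph a b) where

  P4-forces-edit : P4Free B → ∀ x₁ y₁ x₂ y₂ →
    E x₁ y₁ ≡ true → E x₂ y₁ ≡ true → E x₂ y₂ ≡ true → E x₁ y₂ ≡ false →
    ∃₂ λ x y → (y ≡ y₁ ⊎ y ≡ y₂) × E x y ≢ B x y
  P4-forces-edit p4 x₁ y₁ x₂ y₂ e₁ e₂ e₃ n₄ with B x₁ y₁ in b₁ | B x₂ y₁ in b₂ | B x₂ y₂ in b₃
  ... | false | _     | _     = x₁ , y₁ , inj₁ refl , ≡true≢≡false e₁ b₁
  ... | true  | false | _     = x₂ , y₁ , inj₁ refl , ≡true≢≡false e₂ b₂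
  ... | true  | true  | false = x₂ , y₂ , inj₂ refl , ≡true≢≡false e₃ b₃
  ... | true  | true  | true  = x₁ , y₂ , inj₂ refl , ≢-sym (≡true≢≡false (p4 x₁ y₁ x₂ y₂ b₁ b₂ b₃) n₄)

  private
    edits : Fin a → Fin b → ℕ
    edits x y = edit (E x y) (B x y)
    open ≤-Reasoning

  two-edits : ∀ {x y x′ y′} → y ≢ y′ → E x y ≢ B x y → E x′ y′ ≢ B x′ y′ → 2 ≤ cost E B
  two-edits {x} {y} {x′} {y′} y≢y′ xy x′y′ with x ≟ᶠ x′
  ... | yes refl = begin
    2                               ≤⟨ +-mono-≤ (edit-≢ xy) (edit-≢ x′y′) ⟩
    edits x y + edits x y′          ≤⟨ sumF-two (edits x) y≢y′ ⟩
    sumF (edits x)                  ≤⟨ sumF-one (sumF ∘ edits) x ⟩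
    cost E B                        ∎
  ... | no x≢x′ = begin
    2                               ≤⟨ +-mono-≤ (≤-trans (edit-≢ xy) (sumF-one (edits x) y))
                                                (≤-trans (edit-≢ x′y′) (sumF-one (edits x′) y′)) ⟩
    sumF (edits x) + sumF (edits x′) ≤⟨ sumF-two (sumF ∘ edits) x≢x′ ⟩
    cost E B                        ∎

copies : ∀ q → Graph a b → Graph (q * a) (q * b)
copies zero    E ()
copies (suc q) E = E ⊕ copies q E

Irreducible-copies : ∀ q {E : Graph a b} → Irreducible E → Irreducible (copies q E)
Irreducible-copies zero    _           = (λ ()) , (λ ())
Irreducible-copies (suc q) irreducible = Irreducible-⊕ _ _ irreducible (Irreducible-copies q irreducible)

MinBiclusterCost-copies : ∀ q {E : Graph a b} {m} →
  MinBiclusterCost E m → MinBiclusterCost (copies q E) (q * m)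
MinBiclusterCost-copies zero    _       = ((λ ()) , P4Free⇒biclusterGraph (λ ()) , refl) , λ _ _ → z≤n
MinBiclusterCost-copies (suc q) minCost =
  MinBiclusterCost-⊕ _ _ minCost (MinBiclusterCost-copies q minCost)

gadget : Graph 3 6
gadget x y = lookup (row x) y
  where
  row : Fin 3 → Vec Bool 6
  row 0F = false ∷ false ∷ true  ∷ true  ∷ true  ∷ true  ∷ []
  row 1F = true  ∷ true  ∷ true  ∷ true  ∷ false ∷ false ∷ []
  row 2F = true  ∷ true  ∷ false ∷ false ∷ false ∷ false ∷ []

gadget-irreducible : Irreducible gadget
gadget-irreducible = from-yes (irreducible? gadget)

gadget-biclustering : Graph 3 6
gadget-biclustering x y = lookup (row x) y
  where
  row : Fin 3 → Vec Bool 6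
  row 0F = false ∷ false ∷ true  ∷ true  ∷ true  ∷ true  ∷ []
  row 1F = true  ∷ true  ∷ false ∷ false ∷ false ∷ false ∷ []
  row 2F = true  ∷ true  ∷ false ∷ false ∷ false ∷ false ∷ []

-- The induced P4s x₂y₀x₁y₂ and x₂y₁x₁y₃ use disjoint sets of columns.
gadget-needs-two-edits : ∀ B → P4Free B → 2 ≤ cost gadget B
gadget-needs-two-edits B p4
  with P4-forces-edit gadget B p4 2F 0F 1F 2F refl refl refl refl
     | P4-forces-edit gadget B p4 2F 1F 1F 3F refl refl refl refl
... | _ , y , y∈ , xy | _ , y′ , y′∈ , x′y′ = two-edits gadget B (columns-differ y∈ y′∈) xy x′y′
  where
  columns-differ : ∀ {y y′ : Fin 6} → y ≡ 0F ⊎ y ≡ 2F → y′ ≡ 1F ⊎ y′ ≡ 3F → y ≢ y′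
  columns-differ (inj₁ refl) (inj₁ refl) ()
  columns-differ (inj₁ refl) (inj₂ refl) ()
  columns-differ (inj₂ refl) (inj₁ refl) ()
  columns-differ (inj₂ refl) (inj₂ refl) ()

gadget-cost : MinBiclusterCost gadget 2
gadget-cost =
  (gadget-biclustering , P4Free⇒biclusterGraph (from-yes (P4Free? gadget-biclustering)) , refl) ,
  λ B bicluster → gadget-needs-two-edits B (biclusterGraph⇒P4Free bicluster)

vertex-count : ∀ q → 2 * (q * 3 + q * 6) ≡ 9 * (q * 2)
vertex-count = solve 1 (λ q → con 2 :* (q :* con 3 :+ q :* con 6) := con 9 :* (q :* con 2)) refl
  where open +-*-Solver

theorem2 : (k : ℕ) → 2 ∣ k → 2 ≤ k →
    Σ ℕ λ a → Σ ℕ λ b → Σ (Graph a b) λ E →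
      (2 * (a + b) ≡ 9 * k) × ¬ Rule1 E × ¬ Rule2 E × ¬ Rule3 E × MinBiclusterCost E k
theorem2 k (divides q refl) _ =
  q * 3 , q * 6 , copies q gadget , vertex-count q ,
  ¬Rule1 irreducible , ¬Rule2 irreducible , ¬Rule3 irreducible , MinBiclusterCost-copies q gadget-cost
  where
  irreducible : Irreducible (copies q gadget)
  irreducible = Irreducible-copies q gadget-irreducible
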